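{- Let $\alpha, \beta, \gamma$ be distinct elements of the finite field $\mathbb{F}_q$. If $a_1, a_2, a_3 \in \mathbb{F}_q^*$ satisfy \[ 0 = \alpha(a_2 - a_1) + \beta(a_3 - a_2) + \gamma(a_1 - a_3) \] and \[ 0 = \alpha(a_2^2 - a_1^2) + \beta(a_3^2 - a_2^2) + \gamma(a_1^2 - a_3^2), \] then $a_1 = a_2 = a_3$.
   Context: $\mathbb{F}_q$ is the finite field with $q$ elements and $\mathbb{F}_q^* = \mathbb{F}_q \setminus \{0\}$. -}

module Defs where

open import Level using (_⊔_) renaming (suc to lsuc)
open import Algebra.Bundles using (CommutativeRing)
open import Data.Nat using (ℕ)
open import Data.Fin using (Fin)
open import Data.Product using (∃)
open import Relation.Nullary using (¬_)
open import Relation.Binary.PropositionalEquality using (_≡_)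

record FiniteField c ℓ : Set (lsuc (c ⊔ ℓ)) where
  field
    commutativeRing : CommutativeRing c ℓ
  open CommutativeRing commutativeRing public
  field
    0≉1       : ¬ (0# ≈ 1#)
    inverse   : ∀ x → ¬ (x ≈ 0#) → ∃ λ y → x * y ≈ 1#
    q         : ℕ
    enum      : Fin q → Carrier
    enum-surj : ∀ x → ∃ λ i → enum i ≈ x
    enum-inj  : ∀ i j → enum i ≈ enum j → i ≡ j

-- Lemma 3.3: for distinct α, β, γ in a finite field, the two relations
--   L = α(a₂ - a₁) + β(a₃ - a₂) + γ(a₁ - a₃) = 0,
--   Q = α(a₂² - a₁²) + β(a₃² - a₂²) + γ(a₁² - a₃²) = 0
-- force a₁ = a₂ = a₃.
--
-- Write d = a₃ - a₂, e = a₃ - a₁, x = a₂ - a₁.  Three polynomial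
-- identities, valid in every commutative ring, drive the argument:
--   (β - γ)(d e) = Q - (a₁ + a₂) L,
--   (α - β) d    = (α - γ) e - L,
--   (α - γ) x    = L - (β - γ) d.
-- Given L = Q = 0, the first gives d e = 0, so d = 0 or e = 0; when e = 0
-- the second gives (α - β) d = 0, so d = 0 in either case; then the third
-- gives x = 0.  The divisions by α - β, β - γ, α - γ use that these are
-- nonzero, hence invertible.
module Submission where

open import Defs
open import Algebra.Bundles using (CommutativeRing; RawRing)
open import Data.Nat as ℕ using (ℕ; zero; suc; _∸_)
open import Data.Nat.Properties using () renaming (_≟_ to _≟ℕ_)
open import Data.Fin.Properties using () renaming (_≟_ to _≟Fin_)
open import Data.Product using (_×_; _,_; ∃; proj₂)
open import Data.Product.Properties using (≡-dec)
open import Data.Sum using (_⊎_; inj₁; inj₂; [_,_]′)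
open import Function using (id)
open import Data.Maybe using (Maybe; just; nothing)
open import Relation.Nullary using (¬_; yes; no)
open import Relation.Binary.PropositionalEquality as ≡ using (_≡_)
import Relation.Binary.Reasoning.Setoid as SetoidReasoning
import Algebra.Solver.Ring.AlmostCommutativeRing as AlmostCommutative
import Algebra.Solver.Ring as RingSolver
import Algebra.Properties.Semiring.Mult as SemiringMult
import Algebra.Properties.Ring as RingProperties
import Algebra.Properties.Group as GroupProperties
import Algebra.Properties.AbelianGroup as AbelianGroupProperties
import Algebra.Properties.CommutativeSemigroup as CommutativeSemigroupProperties

-- An integer is a pair (m , n) of naturals standing for
-- m - n; sums and products are normalised to (m ∸ n , n ∸ m), so equal
-- integers have identical representations and normal forms can be
-- compared by refl.
module IntegerCoefficientSolver {c ℓ} (R : CommutativeRing c ℓ) where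
  open CommutativeRing R
  open SemiringMult semiring using (×-homo-+; ×1-homo-*) renaming (_×_ to _·_)
  open RingProperties ring using (x[y-z]≈xy-xz; [y-z]x≈yx-zx)
  open GroupProperties +-group using (ε⁻¹≈ε)
  open AbelianGroupProperties +-abelianGroup using (⁻¹-∙-comm; ⁻¹-anti-homo‿-)
  open CommutativeSemigroupProperties +-commutativeSemigroup using (interchange)
  open SetoidReasoning setoid

  Integer : Set
  Integer = ℕ × ℕ

  normalise : Integer → Integer
  normalise (m , n) = (m ∸ n , n ∸ m)

  ⟦_⟧ℤ : Integer → Carrier
  ⟦ m , n ⟧ℤ = m · 1# - n · 1#

  sub-interchange : ∀ p q r s → (p + r) - (q + s) ≈ (p - q) + (r - s)
  sub-interchange p q r s = begin
    (p + r) + - (q + s)    ≈⟨ +-congˡ (⁻¹-∙-comm q s) ⟨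
    (p + r) + (- q + - s)  ≈⟨ interchange p r (- q) (- s) ⟩
    (p - q) + (r - s)      ∎

  cancel-one : ∀ p q → (1# + p) - (1# + q) ≈ p - q
  cancel-one p q = begin
    (1# + p) - (1# + q)  ≈⟨ sub-interchange 1# 1# p q ⟩
    (1# - 1#) + (p - q)  ≈⟨ +-congʳ (-‿inverseʳ 1#) ⟩
    0# + (p - q)         ≈⟨ +-identityˡ (p - q) ⟩
    p - q                ∎

  product-of-differences : ∀ p q r s →
    (p - q) * (r - s) ≈ (p * r + q * s) - (p * s + q * r)
  product-of-differences p q r s = begin
    (p - q) * (r - s)                        ≈⟨ [y-z]x≈yx-zx (r - s) p q ⟩
    p * (r - s) - q * (r - s)                ≈⟨ +-cong (x[y-z]≈xy-xz p r s) (-‿cong (x[y-z]≈xy-xz q r s)) ⟩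
    (p * r - p * s) - (q * r - q * s)        ≈⟨ +-congˡ (⁻¹-anti-homo‿- (q * r) (q * s)) ⟩
    (p * r - p * s) + (q * s - q * r)        ≈⟨ sub-interchange (p * r) (p * s) (q * s) (q * r) ⟨
    (p * r + q * s) - (p * s + q * r)        ∎

  normalise-sound : ∀ m n → ⟦ normalise (m , n) ⟧ℤ ≈ ⟦ m , n ⟧ℤ
  normalise-sound zero    zero    = refl
  normalise-sound zero    (suc n) = refl
  normalise-sound (suc m) zero    = refl
  normalise-sound (suc m) (suc n) = trans (normalise-sound m n) (sym (cancel-one (m · 1#) (n · 1#)))

  integers : RawRing _ _
  integers = record
    { Carrier = Integer
    ; _≈_     = _≡_
    ; _+_     = λ { (m , n) (m′ , n′) → normalise (m ℕ.+ m′ , n ℕ.+ n′) }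
    ; _*_     = λ { (m , n) (m′ , n′) →
                  normalise (m ℕ.* m′ ℕ.+ n ℕ.* n′ , m ℕ.* n′ ℕ.+ n ℕ.* m′) }
    ; -_      = λ { (m , n) → (n , m) }
    ; 0#      = (0 , 0)
    ; 1#      = (1 , 0)
    }

  +-homomorphic : ∀ m n m′ n′ →
    ⟦ normalise (m ℕ.+ m′ , n ℕ.+ n′) ⟧ℤ ≈ ⟦ m , n ⟧ℤ + ⟦ m′ , n′ ⟧ℤ
  +-homomorphic m n m′ n′ = begin
    ⟦ normalise (m ℕ.+ m′ , n ℕ.+ n′) ⟧ℤ     ≈⟨ normalise-sound (m ℕ.+ m′) (n ℕ.+ n′) ⟩
    (m ℕ.+ m′) · 1# - (n ℕ.+ n′) · 1#       ≈⟨ +-cong (×-homo-+ 1# m m′) (-‿cong (×-homo-+ 1# n n′)) ⟩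
    (m · 1# + m′ · 1#) - (n · 1# + n′ · 1#) ≈⟨ sub-interchange _ _ _ _ ⟩
    ⟦ m , n ⟧ℤ + ⟦ m′ , n′ ⟧ℤ                ∎

  *-homomorphic : ∀ m n m′ n′ →
    ⟦ normalise (m ℕ.* m′ ℕ.+ n ℕ.* n′ , m ℕ.* n′ ℕ.+ n ℕ.* m′) ⟧ℤ ≈ ⟦ m , n ⟧ℤ * ⟦ m′ , n′ ⟧ℤ
  *-homomorphic m n m′ n′ = begin
    ⟦ normalise (m ℕ.* m′ ℕ.+ n ℕ.* n′ , m ℕ.* n′ ℕ.+ n ℕ.* m′) ⟧ℤ
      ≈⟨ normalise-sound (m ℕ.* m′ ℕ.+ n ℕ.* n′) (m ℕ.* n′ ℕ.+ n ℕ.* m′) ⟩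
    (m ℕ.* m′ ℕ.+ n ℕ.* n′) · 1# - (m ℕ.* n′ ℕ.+ n ℕ.* m′) · 1#
      ≈⟨ +-cong (embed-sum m m′ n n′) (-‿cong (embed-sum m n′ n m′)) ⟩
    (M * M′ + N * N′) - (M * N′ + N * M′)
      ≈⟨ product-of-differences M N M′ N′ ⟨
    ⟦ m , n ⟧ℤ * ⟦ m′ , n′ ⟧ℤ
      ∎
    where
    M = m · 1#; N = n · 1#; M′ = m′ · 1#; N′ = n′ · 1#
    embed-sum : ∀ i j k l → (i ℕ.* j ℕ.+ k ℕ.* l) · 1# ≈ (i · 1#) * (j · 1#) + (k · 1#) * (l · 1#)
    embed-sum i j k l = trans (×-homo-+ 1# (i ℕ.* j) (k ℕ.* l)) (+-cong (×1-homo-* i j) (×1-homo-* k l))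

  homomorphism : integers AlmostCommutative.-Raw-AlmostCommutative⟶ AlmostCommutative.fromCommutativeRing R
  homomorphism = record
    { ⟦_⟧    = ⟦_⟧ℤ
    ; +-homo = λ { (m , n) (m′ , n′) → +-homomorphic m n m′ n′ }
    ; *-homo = λ { (m , n) (m′ , n′) → *-homomorphic m n m′ n′ }
    ; -‿homo = λ { (m , n) → sym (⁻¹-anti-homo‿- (m · 1#) (n · 1#)) }
    ; 0-homo = -‿inverseʳ 0#
    ; 1-homo = trans (+-congˡ ε⁻¹≈ε) (trans (+-identityʳ _) (+-identityʳ 1#))
    }

  coefficient-equality : ∀ i j → Maybe (⟦ i ⟧ℤ ≈ ⟦ j ⟧ℤ)
  coefficient-equality i j with ≡-dec _≟ℕ_ _≟ℕ_ i j
  ... | yes ≡.refl = just refl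
  ... | no _     = nothing

  open RingSolver integers (AlmostCommutative.fromCommutativeRing R) homomorphism coefficient-equality public
    using (solve; _:=_; _:+_; _:-_; _:*_)

module Relations {c ℓ} (R : CommutativeRing c ℓ) where
  open CommutativeRing R
  open IntegerCoefficientSolver R

  linear : (α β γ a₁ a₂ a₃ : Carrier) → Carrier
  linear α β γ a₁ a₂ a₃ = α * (a₂ - a₁) + β * (a₃ - a₂) + γ * (a₁ - a₃)

  quadratic : (α β γ a₁ a₂ a₃ : Carrier) → Carrier
  quadratic α β γ a₁ a₂ a₃ =
    α * (a₂ * a₂ - a₁ * a₁) + β * (a₃ * a₃ - a₂ * a₂) + γ * (a₁ * a₁ - a₃ * a₃)

  -- Eliminating α from Q using L leaves the product (a₃ - a₂)(a₃ - a₁).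
  quadratic-elimination : ∀ α β γ a₁ a₂ a₃ →
    (β - γ) * ((a₃ - a₂) * (a₃ - a₁)) ≈
      quadratic α β γ a₁ a₂ a₃ - (a₁ + a₂) * linear α β γ a₁ a₂ a₃
  quadratic-elimination α β γ a₁ a₂ a₃ = solve 6 (λ α β γ a₁ a₂ a₃ →
    (β :- γ) :* ((a₃ :- a₂) :* (a₃ :- a₁)) :=
      (α :* (a₂ :* a₂ :- a₁ :* a₁) :+ β :* (a₃ :* a₃ :- a₂ :* a₂) :+ γ :* (a₁ :* a₁ :- a₃ :* a₃))
      :- (a₁ :+ a₂) :* (α :* (a₂ :- a₁) :+ β :* (a₃ :- a₂) :+ γ :* (a₁ :- a₃))) refl α β γ a₁ a₂ a₃

  linear-via-a₃ : ∀ α β γ a₁ a₂ a₃ →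
    (α - β) * (a₃ - a₂) ≈ (α - γ) * (a₃ - a₁) - linear α β γ a₁ a₂ a₃
  linear-via-a₃ α β γ a₁ a₂ a₃ = solve 6 (λ α β γ a₁ a₂ a₃ →
    (α :- β) :* (a₃ :- a₂) :=
      (α :- γ) :* (a₃ :- a₁) :- (α :* (a₂ :- a₁) :+ β :* (a₃ :- a₂) :+ γ :* (a₁ :- a₃))) refl α β γ a₁ a₂ a₃

  linear-via-a₁ : ∀ α β γ a₁ a₂ a₃ →
    (α - γ) * (a₂ - a₁) ≈ linear α β γ a₁ a₂ a₃ - (β - γ) * (a₃ - a₂)
  linear-via-a₁ α β γ a₁ a₂ a₃ = solve 6 (λ α β γ a₁ a₂ a₃ →
    (α :- γ) :* (a₂ :- a₁) :=
      (α :* (a₂ :- a₁) :+ β :* (a₃ :- a₂) :+ γ :* (a₁ :- a₃)) :- (β :- γ) :* (a₃ :- a₂)) refl α β γ a₁ a₂ a₃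

module Zeros {c ℓ} (R : CommutativeRing c ℓ) where
  open CommutativeRing R
  open GroupProperties +-group using (x∙y⁻¹≈ε⇒x≈y)
  open SetoidReasoning setoid

  multiple-of-zero : ∀ a {b} → b ≈ 0# → a * b ≈ 0#
  multiple-of-zero a b≈0 = trans (*-congˡ b≈0) (zeroʳ a)

  difference-of-zeros : ∀ {p q} → p ≈ 0# → q ≈ 0# → p - q ≈ 0#
  difference-of-zeros {p} {q} p≈0 q≈0 = begin
    p - q    ≈⟨ +-cong p≈0 (-‿cong q≈0) ⟩
    0# - 0#  ≈⟨ -‿inverseʳ 0# ⟩
    0#       ∎

  difference-nonzero : ∀ {u v} → ¬ (u ≈ v) → ¬ (u - v ≈ 0#)
  difference-nonzero {u} {v} u≉v u-v≈0 = u≉v (x∙y⁻¹≈ε⇒x≈y u v u-v≈0)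

  unit-cancel : ∀ {a a′ b} → a * a′ ≈ 1# → a * b ≈ 0# → b ≈ 0#
  unit-cancel {a} {a′} {b} aa′≈1 ab≈0 = begin
    b               ≈⟨ *-identityˡ b ⟨
    1# * b          ≈⟨ *-congʳ aa′≈1 ⟨
    (a * a′) * b    ≈⟨ *-congʳ (*-comm a a′) ⟩
    (a′ * a) * b    ≈⟨ *-assoc a′ a b ⟩
    a′ * (a * b)    ≈⟨ multiple-of-zero a′ ab≈0 ⟩
    0#              ∎

  module Field (inverse : ∀ x → ¬ (x ≈ 0#) → ∃ λ y → x * y ≈ 1#)
               (_≟_ : ∀ x y → (x ≈ y) ⊎ ¬ (x ≈ y)) where

    cancel-nonzero : ∀ {a b} → ¬ (a ≈ 0#) → a * b ≈ 0# → b ≈ 0#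
    cancel-nonzero {a} a≉0 = unit-cancel (proj₂ (inverse a a≉0))

    zero-product : ∀ {a b} → a * b ≈ 0# → (a ≈ 0#) ⊎ (b ≈ 0#)
    zero-product {a} ab≈0 with a ≟ 0#
    ... | inj₁ a≈0 = inj₁ a≈0
    ... | inj₂ a≉0 = inj₂ (cancel-nonzero a≉0 ab≈0)

module FiniteFieldEquality {c ℓ} (F : FiniteField c ℓ) where
  open FiniteField F

  decide-equality : ∀ x y → (x ≈ y) ⊎ ¬ (x ≈ y)
  decide-equality x y with enum-surj x | enum-surj y
  ... | i , eᵢ≈x | j , eⱼ≈y with i ≟Fin j
  ...   | yes ≡.refl = inj₁ (trans (sym eᵢ≈x) eⱼ≈y)
  ...   | no i≢j     = inj₂ (λ x≈y → i≢j (enum-inj i j (trans eᵢ≈x (trans x≈y (sym eⱼ≈y)))))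

lemma3p3 : ∀ {c ℓ} (F : FiniteField c ℓ) → let open FiniteField F in
    (α β γ a₁ a₂ a₃ : Carrier) →
    ¬ (α ≈ β) → ¬ (β ≈ γ) → ¬ (α ≈ γ) →
    ¬ (a₁ ≈ 0#) → ¬ (a₂ ≈ 0#) → ¬ (a₃ ≈ 0#) →
    0# ≈ α * (a₂ - a₁) + β * (a₃ - a₂) + γ * (a₁ - a₃) →
    0# ≈ α * (a₂ * a₂ - a₁ * a₁) + β * (a₃ * a₃ - a₂ * a₂) + γ * (a₁ * a₁ - a₃ * a₃) →
    (a₁ ≈ a₂) × (a₂ ≈ a₃)
lemma3p3 F α β γ a₁ a₂ a₃ α≉β β≉γ α≉γ _ _ _ 0≈L 0≈Q =
  sym (x∙y⁻¹≈ε⇒x≈y a₂ a₁ a₂-a₁≈0) , sym (x∙y⁻¹≈ε⇒x≈y a₃ a₂ a₃-a₂≈0)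
  where
  open FiniteField F
  open Relations commutativeRing
  open Zeros commutativeRing
  open Field inverse (FiniteFieldEquality.decide-equality F)
  open GroupProperties +-group using (x∙y⁻¹≈ε⇒x≈y)

  L≈0 : linear α β γ a₁ a₂ a₃ ≈ 0#
  L≈0 = sym 0≈L

  Q≈0 : quadratic α β γ a₁ a₂ a₃ ≈ 0#
  Q≈0 = sym 0≈Q

  d·e≈0 : (a₃ - a₂) * (a₃ - a₁) ≈ 0#
  d·e≈0 = cancel-nonzero (difference-nonzero β≉γ)
    (trans (quadratic-elimination α β γ a₁ a₂ a₃)
           (difference-of-zeros Q≈0 (multiple-of-zero (a₁ + a₂) L≈0)))

  a₃-a₂≈0-if-a₃-a₁≈0 : a₃ - a₁ ≈ 0# → a₃ - a₂ ≈ 0#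
  a₃-a₂≈0-if-a₃-a₁≈0 e≈0 = cancel-nonzero (difference-nonzero α≉β)
    (trans (linear-via-a₃ α β γ a₁ a₂ a₃)
           (difference-of-zeros (multiple-of-zero (α - γ) e≈0) L≈0))

  a₃-a₂≈0 : a₃ - a₂ ≈ 0#
  a₃-a₂≈0 = [ id , a₃-a₂≈0-if-a₃-a₁≈0 ]′ (zero-product d·e≈0)

  a₂-a₁≈0 : a₂ - a₁ ≈ 0#
  a₂-a₁≈0 = cancel-nonzero (difference-nonzero α≉γ)
    (trans (linear-via-a₁ α β γ a₁ a₂ a₃)
           (difference-of-zeros L≈0 (multiple-of-zero (β - γ) a₃-a₂≈0)))
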